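{- If $\mathcal{P}$ is a $\mathcal{V}$-poset, then $e_\mathcal{P}=n_\mathcal{P}+w_\mathcal{P}-M_\mathcal{P}-m_\mathcal{P}$.
   Context: A $\mathcal{V}$-poset is a finite poset obtainable from the one-element poset by iteratively applying the operations: (1) disjoint union of two $\mathcal{V}$-posets, (2) adding a new greatest element, (3) adding a new least element. For a finite poset $\mathcal{P}$: $n_\mathcal{P}$ is the number of elements, $e_\mathcal{P}$ the number of cover relations (edges of the Hasse diagram), $w_\mathcal{P}$ the width (maximum size of an antichain), and $M_\mathcal{P}$, $m_\mathcal{P}$ the numbers of maximal and minimal elements, respectively. -}

module Defs where

open import Data.Nat using (ℕ; zero; suc; _+_; _≤_)
open import Data.Fin using (Fin; zero; suc; splitAt; _≟_)
open import Data.Fin.Properties using (all?; any?)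
open import Data.List using (List; length; filter; allFin; map)
open import Data.Nat.ListAction using (sum)
open import Data.List.Relation.Unary.AllPairs using (AllPairs)
open import Data.Sum using (_⊎_; inj₁; inj₂)
open import Data.Product using (_×_; _,_; ∃-syntax)
open import Data.Unit using (⊤; tt)
open import Data.Empty using (⊥)
open import Relation.Nullary using (¬_; Dec; yes; no)
open import Relation.Nullary.Decidable using (_×-dec_; ¬?)
open import Relation.Binary.PropositionalEquality using (_≡_; _≢_)

record FinRel : Set₁ where
  field
    size : ℕ
    _≼_  : Fin size → Fin size → Set
    _≼?_ : (x y : Fin size) → Dec (x ≼ y)

count : ∀ {n} {P : Fin n → Set} → ((x : Fin n) → Dec (P x)) → ℕ
count {n} P? = length (filter P? (allFin n))

module _ (P : FinRel) where
  open FinRel P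

  _≺_ : Fin size → Fin size → Set
  x ≺ y = x ≼ y × x ≢ y

  _≺?_ : (x y : Fin size) → Dec (x ≺ y)
  x ≺? y = (x ≼? y) ×-dec ¬? (x ≟ y)

  Covers : Fin size → Fin size → Set
  Covers x y = x ≺ y × (∀ z → ¬ (x ≺ z × z ≺ y))

  Covers? : (x y : Fin size) → Dec (Covers x y)
  Covers? x y = (x ≺? y) ×-dec all? (λ z → ¬? ((x ≺? z) ×-dec (z ≺? y)))

  IsMaximal IsMinimal : Fin size → Set
  IsMaximal x = ∀ y → ¬ (x ≺ y)
  IsMinimal x = ∀ y → ¬ (y ≺ x)

  IsMaximal? : (x : Fin size) → Dec (IsMaximal x)
  IsMinimal? : (x : Fin size) → Dec (IsMinimal x)
  IsMaximal? x = all? (λ y → ¬? (x ≺? y))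
  IsMinimal? x = all? (λ y → ¬? (y ≺? x))

  nP : ℕ
  nP = size

  eP : ℕ
  eP = sum (map (λ x → count (Covers? x)) (allFin size))

  MP mP : ℕ
  MP = count IsMaximal?
  mP = count IsMinimal?

  -- an antichain: a list of pairwise incomparable elements
  -- (pairwise incomparability forces the elements to be distinct)
  Incomparable : Fin size → Fin size → Set
  Incomparable x y = ¬ (x ≼ y) × ¬ (y ≼ x)

  Antichain : List (Fin size) → Set
  Antichain = AllPairs Incomparable

  IsWidth : ℕ → Set
  IsWidth w = (∃[ as ] (Antichain as × length as ≡ w))
            × (∀ as → Antichain as → length as ≤ w)

-- 𝒱-posets: syntax of the three operations, starting from the
-- one-element poset.

data VTree : Set where
  point : VTree
  _⊕_   : VTree → VTree → VTree
  addTop : VTree → VTree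
  addBot : VTree → VTree

vsize : VTree → ℕ
vsize point      = 1
vsize (t ⊕ s)    = vsize t + vsize s
vsize (addTop t) = suc (vsize t)
vsize (addBot t) = suc (vsize t)

-- Disjoint union: Fin (a + b) ≅ Fin a ⊎ Fin b via splitAt; elements of
-- different summands are incomparable.
-- addTop / addBot: the new element is zero, old elements are suc x.
VLe : (t : VTree) → Fin (vsize t) → Fin (vsize t) → Set
VLeSum : (t s : VTree) → Fin (vsize t) ⊎ Fin (vsize s) → Fin (vsize t) ⊎ Fin (vsize s) → Set
VLe point _ _ = ⊤
VLe (t ⊕ s) x y = VLeSum t s (splitAt (vsize t) x) (splitAt (vsize t) y)
VLe (addTop t) x       zero    = ⊤
VLe (addTop t) zero    (suc y) = ⊥
VLe (addTop t) (suc x) (suc y) = VLe t x y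
VLe (addBot t) zero    y       = ⊤
VLe (addBot t) (suc x) zero    = ⊥
VLe (addBot t) (suc x) (suc y) = VLe t x y
VLeSum t s (inj₁ a) (inj₁ b) = VLe t a b
VLeSum t s (inj₁ a) (inj₂ b) = ⊥
VLeSum t s (inj₂ a) (inj₁ b) = ⊥
VLeSum t s (inj₂ a) (inj₂ b) = VLe s a b

VLe? : (t : VTree) → (x y : Fin (vsize t)) → Dec (VLe t x y)
VLeSum? : (t s : VTree) → (x y : Fin (vsize t) ⊎ Fin (vsize s)) → Dec (VLeSum t s x y)
VLe? point _ _ = yes tt
VLe? (t ⊕ s) x y = VLeSum? t s (splitAt (vsize t) x) (splitAt (vsize t) y)
VLe? (addTop t) x       zero    = yes tt
VLe? (addTop t) zero    (suc y) = no (λ ())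
VLe? (addTop t) (suc x) (suc y) = VLe? t x y
VLe? (addBot t) zero    y       = yes tt
VLe? (addBot t) (suc x) zero    = no (λ ())
VLe? (addBot t) (suc x) (suc y) = VLe? t x y
VLeSum? t s (inj₁ a) (inj₁ b) = VLe? t a b
VLeSum? t s (inj₁ a) (inj₂ b) = no (λ ())
VLeSum? t s (inj₂ a) (inj₁ b) = no (λ ())
VLeSum? t s (inj₂ a) (inj₂ b) = VLe? s a b

⟦_⟧ : VTree → FinRel
⟦ t ⟧ = record { size = vsize t ; _≼_ = VLe t ; _≼?_ = VLe? t }

-- Counting the edges of the Hasse diagram row by row, e, M, m, n and the
-- width w are all additive under disjoint union. Adjoining a greatest element
-- to a nonempty poset adds one element, keeps w and m, makes M = 1 and adds
-- one edge from each old maximal element to the new one, so e + M + m - n - w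
-- does not change; adjoining a least element is the dual case. As
-- e + M + m = n + w for the one-element poset, it holds for every 𝒱-poset,
-- whose width is its number of leaves.

module Submission where

open import Defs
open import Data.Nat using (ℕ)
open import Data.Integer using (ℤ; +_; _+_; _-_)
open import Relation.Binary.PropositionalEquality using (_≡_)

open import Data.Nat as ℕ using (zero; suc; _≤_)
import Data.Nat.Properties as ℕₚ
open import Data.Nat.Tactic.RingSolver using (solve-∀)
open import Data.Nat.ListAction as List using ()
import Data.Integer.Properties as ℤₚ
import Data.Integer.Tactic.RingSolver as ℤ-Solver
open import Data.Fin using (Fin; zero; suc; splitAt; join; _↑ˡ_; _↑ʳ_)
import Data.Fin.Properties as Finₚ
open import Data.List using (List; []; _∷_; [_]; _++_; length; map; filter; tabulate; allFin)
import Data.List.Properties as Listₚ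
open import Data.List.Relation.Unary.All as All using (All; []; _∷_)
import Data.List.Relation.Unary.All.Properties as Allₚ
open import Data.List.Relation.Unary.AllPairs as AllPairs using (AllPairs; []; _∷_)
import Data.List.Relation.Unary.AllPairs.Properties as AllPairsₚ
open import Data.Product using (_×_; _,_; ∃-syntax; proj₁; proj₂; swap; map₂)
import Data.Product as Product
open import Data.Sum as Sum using (_⊎_; inj₁; inj₂)
open import Data.Empty using (⊥-elim)
open import Data.Unit using (tt)
open import Function using (_∘_; _on_; flip; id; _⇔_; mk⇔; Equivalence)
open import Function.Construct.Identity using (⇔-id)
open import Relation.Nullary using (¬_; Dec; yes; no; contradiction)
open import Relation.Binary.PropositionalEquality
  using (refl; sym; trans; cong; cong₂; subst; subst₂; ≢-sym; module ≡-Reasoning)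

open import Algebra.Properties.CommutativeSemigroup ℕₚ.+-commutativeSemigroup
  using () renaming (interchange to +-interchange)
open import Algebra.Properties.CommutativeMonoid.Sum ℕₚ.+-0-commutativeMonoid
  using (sum-syntax; sum-cong-≗; ∑-distrib-+; ∑-comm; sum-replicate-zero)

open FinRel using (size)
open Equivalence using (to; from)

indicator : ∀ {p} {P : Set p} → Dec P → ℕ
indicator (yes _) = 1
indicator (no _)  = 0

indicator-yes : ∀ {P : Set} (P? : Dec P) → P → indicator P? ≡ 1
indicator-yes (yes _) _ = refl
indicator-yes (no ¬p) p = contradiction p ¬p

indicator-no : ∀ {P : Set} (P? : Dec P) → ¬ P → indicator P? ≡ 0
indicator-no (yes p) ¬p = contradiction p ¬p
indicator-no (no _)  _  = refl

indicator-cong : ∀ {P Q : Set} (P? : Dec P) (Q? : Dec Q) → P ⇔ Q → indicator P? ≡ indicator Q?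
indicator-cong (yes _) (yes _)  _   = refl
indicator-cong (yes p) (no ¬q)  P⇔Q = contradiction (to P⇔Q p) ¬q
indicator-cong (no ¬p) (yes q)  P⇔Q = contradiction (from P⇔Q q) ¬p
indicator-cong (no _)  (no _)   _   = refl

length-filter≡sum : ∀ {A : Set} {P : A → Set} (P? : ∀ x → Dec (P x)) xs →
                    length (filter P? xs) ≡ List.sum (map (indicator ∘ P?) xs)
length-filter≡sum P? []       = refl
length-filter≡sum P? (x ∷ xs) with P? x
... | yes _ = cong suc (length-filter≡sum P? xs)
... | no _  = length-filter≡sum P? xs

sum-tabulate : ∀ {n} (f : Fin n → ℕ) → List.sum (tabulate f) ≡ ∑[ x < n ] f x
sum-tabulate {zero}  f = refl
sum-tabulate {suc n} f = cong (f zero ℕ.+_) (sum-tabulate (f ∘ suc))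

sum-map-allFin : ∀ n (f : Fin n → ℕ) → List.sum (map f (allFin n)) ≡ ∑[ x < n ] f x
sum-map-allFin n f = trans (cong List.sum (Listₚ.map-tabulate id f)) (sum-tabulate f)

∑-↑ : ∀ m {n} (f : Fin (m ℕ.+ n) → ℕ) →
      ∑[ x < m ℕ.+ n ] f x ≡ ∑[ i < m ] f (i ↑ˡ n) ℕ.+ ∑[ j < n ] f (m ↑ʳ j)
∑-↑ zero    f = refl
∑-↑ (suc m) f = trans (cong (f zero ℕ.+_) (∑-↑ m (f ∘ suc))) (sym (ℕₚ.+-assoc (f zero) _ _))

count≡∑ : ∀ {n} {P : Fin n → Set} (P? : ∀ x → Dec (P x)) → count P? ≡ ∑[ x < n ] indicator (P? x)
count≡∑ {n} P? = trans (length-filter≡sum P? (allFin n)) (sum-map-allFin n _)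

module _ {n} {P : Fin n → Set} (P? : ∀ x → Dec (P x)) where

  count-none : (∀ x → ¬ P x) → count P? ≡ 0
  count-none ¬P = trans (count≡∑ P?)
    (trans (sum-cong-≗ (λ x → indicator-no (P? x) (¬P x))) (sum-replicate-zero n))

  count-cong : ∀ {Q : Fin n → Set} (Q? : ∀ x → Dec (Q x)) → (∀ x → P x ⇔ Q x) → count P? ≡ count Q?
  count-cong Q? P⇔Q = begin
    count P?                       ≡⟨ count≡∑ P? ⟩
    ∑[ x < n ] indicator (P? x)    ≡⟨ sum-cong-≗ (λ x → indicator-cong (P? x) (Q? x) (P⇔Q x)) ⟩
    ∑[ x < n ] indicator (Q? x)    ≡⟨ count≡∑ Q? ⟨
    count Q?                       ∎
    where open ≡-Reasoning

count-suc : ∀ {n} {P : Fin (suc n) → Set} (P? : ∀ x → Dec (P x)) →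
            count P? ≡ indicator (P? zero) ℕ.+ count (λ x → P? (suc x))
count-suc P? = trans (count≡∑ P?) (cong (indicator (P? zero) ℕ.+_) (sym (count≡∑ (λ x → P? (suc x)))))

count-↑ : ∀ m {n} {P : Fin (m ℕ.+ n) → Set} (P? : ∀ x → Dec (P x)) →
          count P? ≡ count (λ i → P? (i ↑ˡ n)) ℕ.+ count (λ j → P? (m ↑ʳ j))
count-↑ m {n} P? = trans (count≡∑ P?) (trans (∑-↑ m {n} _)
  (sym (cong₂ ℕ._+_ (count≡∑ (λ i → P? (i ↑ˡ n))) (count≡∑ (λ j → P? (m ↑ʳ j))))))

eP≡∑count : ∀ P → eP P ≡ ∑[ x < size P ] count (Covers? P x)
eP≡∑count P = sum-map-allFin (size P) _

eP≡∑∑ : ∀ P → eP P ≡ ∑[ x < size P ] ∑[ y < size P ] indicator (Covers? P x y)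
eP≡∑∑ P = trans (eP≡∑count P) (sum-cong-≗ (λ x → count≡∑ (Covers? P x)))

-- The theorem with all terms moved to one side, so that it lives in ℕ.
Balanced : FinRel → ℕ → Set
Balanced P w = eP P ℕ.+ MP P ℕ.+ mP P ≡ nP P ℕ.+ w

IsWidth-unique : ∀ P {v w} → IsWidth P v → IsWidth P w → v ≡ w
IsWidth-unique P ((as , as-anti , refl) , v-max) ((bs , bs-anti , refl) , w-max) =
  ℕₚ.≤-antisym (w-max as as-anti) (v-max bs bs-anti)

-- The opposite order

_ᵒᵖ : FinRel → FinRel
P ᵒᵖ = record { size = size P ; _≼_ = flip (FinRel._≼_ P) ; _≼?_ = flip (FinRel._≼?_ P) }

module _ (P : FinRel) where

  ≺-ᵒᵖ : ∀ {x y} → _≺_ (P ᵒᵖ) x y ⇔ _≺_ P y x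
  ≺-ᵒᵖ = mk⇔ (map₂ ≢-sym) (map₂ ≢-sym)

  Covers-ᵒᵖ : ∀ {x y} → Covers (P ᵒᵖ) x y ⇔ Covers P y x
  Covers-ᵒᵖ = mk⇔
    (λ (x<y , nothing-between) → to ≺-ᵒᵖ x<y , λ z (y<z , z<x) → nothing-between z (from ≺-ᵒᵖ z<x , from ≺-ᵒᵖ y<z))
    (λ (y<x , nothing-between) → from ≺-ᵒᵖ y<x , λ z (x<z , z<y) → nothing-between z (to ≺-ᵒᵖ z<y , to ≺-ᵒᵖ x<z))

  IsMaximal-ᵒᵖ : ∀ {x} → IsMaximal (P ᵒᵖ) x ⇔ IsMinimal P x
  IsMaximal-ᵒᵖ = mk⇔ (λ max y y<x → max y (from ≺-ᵒᵖ y<x)) (λ min y x<y → min y (to ≺-ᵒᵖ x<y))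

  eP-ᵒᵖ : eP (P ᵒᵖ) ≡ eP P
  eP-ᵒᵖ = begin
    eP (P ᵒᵖ)                                     ≡⟨ eP≡∑∑ (P ᵒᵖ) ⟩
    ∑[ x < n ] ∑[ y < n ] indicator (Covers? (P ᵒᵖ) x y)
      ≡⟨ sum-cong-≗ (λ x → sum-cong-≗ (λ y → indicator-cong (Covers? (P ᵒᵖ) x y) _ Covers-ᵒᵖ)) ⟩
    ∑[ x < n ] ∑[ y < n ] indicator (Covers? P y x) ≡⟨ ∑-comm (λ x y → indicator (Covers? P y x)) ⟩
    ∑[ y < n ] ∑[ x < n ] indicator (Covers? P y x) ≡⟨ eP≡∑∑ P ⟨
    eP P                                          ∎
    where
    open ≡-Reasoning
    n : ℕ
    n = size P

  MP-ᵒᵖ : MP (P ᵒᵖ) ≡ mP P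
  MP-ᵒᵖ = count-cong (IsMaximal? (P ᵒᵖ)) (IsMinimal? P) (λ _ → IsMaximal-ᵒᵖ)

  Antichain-ᵒᵖ : ∀ {as} → Antichain P as → Antichain (P ᵒᵖ) as
  Antichain-ᵒᵖ = AllPairs.map swap

mP-ᵒᵖ : ∀ P → mP (P ᵒᵖ) ≡ MP P
mP-ᵒᵖ P = sym (MP-ᵒᵖ (P ᵒᵖ))

Balanced-ᵒᵖ : ∀ P {w} → Balanced P w → Balanced (P ᵒᵖ) w
Balanced-ᵒᵖ P {w} balanced = begin
  eP (P ᵒᵖ) ℕ.+ MP (P ᵒᵖ) ℕ.+ mP (P ᵒᵖ) ≡⟨ cong₂ ℕ._+_ (cong₂ ℕ._+_ (eP-ᵒᵖ P) (MP-ᵒᵖ P)) (mP-ᵒᵖ P) ⟩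
  eP P ℕ.+ mP P ℕ.+ MP P               ≡⟨ ℕₚ.+-assoc (eP P) _ _ ⟩
  eP P ℕ.+ (mP P ℕ.+ MP P)             ≡⟨ cong (eP P ℕ.+_) (ℕₚ.+-comm (mP P) (MP P)) ⟩
  eP P ℕ.+ (MP P ℕ.+ mP P)             ≡⟨ ℕₚ.+-assoc (eP P) _ _ ⟨
  eP P ℕ.+ MP P ℕ.+ mP P               ≡⟨ balanced ⟩
  size P ℕ.+ w                         ∎
  where open ≡-Reasoning

IsWidth-ᵒᵖ : ∀ P {w} → IsWidth P w → IsWidth (P ᵒᵖ) w
IsWidth-ᵒᵖ P ((as , as-anti , as-length) , w-max) =
  (as , Antichain-ᵒᵖ P as-anti , as-length) , λ bs bs-anti → w-max bs (Antichain-ᵒᵖ (P ᵒᵖ) bs-anti)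

-- Order embeddings

module OrderEmbedding
  (Q P : FinRel)
  (f : Fin (size Q) → Fin (size P))
  (f-injective : ∀ {x y} → f x ≡ f y → x ≡ y)
  (f-≼ : ∀ x y → FinRel._≼_ P (f x) (f y) ⇔ FinRel._≼_ Q x y)
  where

  ≺⇔ : ∀ {x y} → _≺_ P (f x) (f y) ⇔ _≺_ Q x y
  ≺⇔ {x} {y} = mk⇔
    (λ (fx≼fy , fx≢fy) → to (f-≼ x y) fx≼fy , fx≢fy ∘ cong f)
    (λ (x≼y , x≢y) → from (f-≼ x y) x≼y , x≢y ∘ f-injective)

  Incomparable⇔ : ∀ {x y} → Incomparable P (f x) (f y) ⇔ Incomparable Q x y
  Incomparable⇔ {x} {y} = mk⇔
    (Product.map (_∘ from (f-≼ x y)) (_∘ from (f-≼ y x)))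
    (Product.map (_∘ to (f-≼ x y)) (_∘ to (f-≼ y x)))

  Antichain-map : ∀ {as} → Antichain Q as → Antichain P (map f as)
  Antichain-map = AllPairsₚ.map⁺ ∘ AllPairs.map (from Incomparable⇔)

  InImage : Fin (size P) → Set
  InImage z = ∃[ z′ ] f z′ ≡ z

  Covers⇔ : ∀ {x y} → (∀ z → _≺_ P (f x) z → _≺_ P z (f y) → InImage z) →
            Covers P (f x) (f y) ⇔ Covers Q x y
  Covers⇔ {x} {y} convex = mk⇔
    (λ (x<y , nothing-between) → to ≺⇔ x<y , λ z (x<z , z<y) → nothing-between (f z) (from ≺⇔ x<z , from ≺⇔ z<y))
    (λ (x<y , nothing-between) → from ≺⇔ x<y , nothing-between′ nothing-between)
    where
    nothing-between′ : (∀ z → ¬ (_≺_ Q x z × _≺_ Q z y)) → ∀ z → ¬ (_≺_ P (f x) z × _≺_ P z (f y))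
    nothing-between′ nothing-between z (x<z , z<y) with convex z x<z z<y
    ... | z′ , refl = nothing-between z′ (to ≺⇔ x<z , to ≺⇔ z<y)

  IsMaximal⇔ : ∀ {x} → (∀ z → _≺_ P (f x) z → InImage z) → IsMaximal P (f x) ⇔ IsMaximal Q x
  IsMaximal⇔ {x} up-closed = mk⇔ (λ max y x<y → max (f y) (from ≺⇔ x<y)) max′
    where
    max′ : IsMaximal Q x → IsMaximal P (f x)
    max′ max z x<z with up-closed z x<z
    ... | z′ , refl = max z′ (to ≺⇔ x<z)

  IsMinimal⇔ : ∀ {x} → (∀ z → _≺_ P z (f x) → InImage z) → IsMinimal P (f x) ⇔ IsMinimal Q x
  IsMinimal⇔ {x} down-closed = mk⇔ (λ min y y<x → min (f y) (from ≺⇔ y<x)) min′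
    where
    min′ : IsMinimal Q x → IsMinimal P (f x)
    min′ min z z<x with down-closed z z<x
    ... | z′ , refl = min z′ (to ≺⇔ z<x)

-- Adjoining a greatest element

module AdjoinGreatest
  (Q : FinRel)
  (_⊑_ : Fin (suc (size Q)) → Fin (suc (size Q)) → Set)
  (_⊑?_ : ∀ x y → Dec (x ⊑ y))
  (suc-⊑ : ∀ x y → suc x ⊑ suc y ⇔ FinRel._≼_ Q x y)
  (⊑-top : ∀ x → x ⊑ zero)
  (top-⋢ : ∀ y → ¬ (zero ⊑ suc y))
  where

  P : FinRel
  P = record { size = suc (size Q) ; _≼_ = _⊑_ ; _≼?_ = _⊑?_ }

  open OrderEmbedding Q P suc Finₚ.suc-injective suc-⊑

  top-maximal : IsMaximal P zero
  top-maximal zero    (_ , 0≢0)   = 0≢0 refl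
  top-maximal (suc y) (0⊑y , _)   = top-⋢ y 0⊑y

  suc≺top : ∀ x → _≺_ P (suc x) zero
  suc≺top x = ⊑-top (suc x) , λ ()

  below-suc : ∀ y z → _≺_ P z (suc y) → InImage z
  below-suc y zero    0<y = ⊥-elim (top-maximal (suc y) 0<y)
  below-suc y (suc z) _   = z , refl

  Covers-top⇔ : ∀ {x} → Covers P (suc x) zero ⇔ IsMaximal Q x
  Covers-top⇔ {x} = mk⇔
    (λ (_ , nothing-between) y x<y → nothing-between (suc y) (from ≺⇔ x<y , suc≺top y))
    (λ max → suc≺top x , nothing-between max)
    where
    nothing-between : IsMaximal Q x → ∀ z → ¬ (_≺_ P (suc x) z × _≺_ P z zero)
    nothing-between max zero    (_ , (_ , 0≢0)) = 0≢0 refl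
    nothing-between max (suc z) (x<z , _)       = max z (to ≺⇔ x<z)

  count-Covers-suc : ∀ x → count (Covers? P (suc x)) ≡ indicator (IsMaximal? Q x) ℕ.+ count (Covers? Q x)
  count-Covers-suc x = trans (count-suc (Covers? P (suc x)))
    (cong₂ ℕ._+_ (indicator-cong (Covers? P (suc x) zero) _ Covers-top⇔)
                 (count-cong (λ y → Covers? P (suc x) (suc y)) (Covers? Q x) (λ y → Covers⇔ (λ z _ → below-suc y z))))

  eP-adjoin : eP P ≡ MP Q ℕ.+ eP Q
  eP-adjoin = begin
    eP P
      ≡⟨ eP≡∑count P ⟩
    count (Covers? P zero) ℕ.+ ∑[ x < n ] count (Covers? P (suc x))
      ≡⟨ cong₂ ℕ._+_ (count-none (Covers? P zero) (λ y → top-maximal y ∘ proj₁)) (sum-cong-≗ count-Covers-suc) ⟩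
    ∑[ x < n ] (indicator (IsMaximal? Q x) ℕ.+ count (Covers? Q x))
      ≡⟨ ∑-distrib-+ (indicator ∘ IsMaximal? Q) (count ∘ Covers? Q) ⟩
    ∑[ x < n ] indicator (IsMaximal? Q x) ℕ.+ ∑[ x < n ] count (Covers? Q x)
      ≡⟨ cong₂ ℕ._+_ (count≡∑ (IsMaximal? Q)) (eP≡∑count Q) ⟨
    MP Q ℕ.+ eP Q
      ∎
    where
    open ≡-Reasoning
    n : ℕ
    n = size Q

  MP-adjoin : MP P ≡ 1
  MP-adjoin = trans (count-suc (IsMaximal? P))
    (cong₂ ℕ._+_ (indicator-yes (IsMaximal? P zero) top-maximal)
                 (count-none (λ x → IsMaximal? P (suc x)) (λ x max → max zero (suc≺top x))))

  -- Q must be nonempty, or the new element would also be minimal.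
  mP-adjoin : Fin (size Q) → mP P ≡ mP Q
  mP-adjoin x₀ = trans (count-suc (IsMinimal? P))
    (cong₂ ℕ._+_ (indicator-no (IsMinimal? P zero) (λ min → min (suc x₀) (suc≺top x₀)))
                 (count-cong (λ x → IsMinimal? P (suc x)) (IsMinimal? Q) (λ x → IsMinimal⇔ (below-suc x))))

  Balanced-adjoin : ∀ {w} → Fin (size Q) → Balanced Q w → Balanced P w
  Balanced-adjoin {w} x₀ balanced = begin
    eP P ℕ.+ MP P ℕ.+ mP P           ≡⟨ cong₂ ℕ._+_ (cong₂ ℕ._+_ eP-adjoin MP-adjoin) (mP-adjoin x₀) ⟩
    MP Q ℕ.+ eP Q ℕ.+ 1 ℕ.+ mP Q     ≡⟨ rearrange (MP Q) (eP Q) (mP Q) ⟩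
    suc (eP Q ℕ.+ MP Q ℕ.+ mP Q)     ≡⟨ cong suc balanced ⟩
    suc (size Q ℕ.+ w)               ∎
    where
    open ≡-Reasoning
    rearrange : ∀ a b c → a ℕ.+ b ℕ.+ 1 ℕ.+ c ≡ suc (b ℕ.+ a ℕ.+ c)
    rearrange = solve-∀

  antichain-view : ∀ as → Antichain P as → as ≡ [ zero ] ⊎ ∃[ bs ] (Antichain Q bs × as ≡ map suc bs)
  antichain-view []              _                     = inj₂ ([] , [] , refl)
  antichain-view (zero ∷ [])     _                     = inj₁ refl
  antichain-view (zero ∷ y ∷ _)  ((0#y ∷ _) ∷ _)       = ⊥-elim (proj₂ 0#y (⊑-top y))
  antichain-view (suc x ∷ as)    (x#as ∷ as-anti) with antichain-view as as-anti
  ... | inj₁ refl                 = ⊥-elim (proj₁ (All.head x#as) (⊑-top (suc x)))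
  ... | inj₂ (bs , bs-anti , refl) =
    inj₂ (x ∷ bs , All.map (to Incomparable⇔) (Allₚ.map⁻ x#as) ∷ bs-anti , refl)

  IsWidth-adjoin : ∀ {w} → Fin (size Q) → IsWidth Q w → IsWidth P w
  IsWidth-adjoin {w} x₀ ((as , as-anti , as-length) , w-max) =
    (map suc as , Antichain-map as-anti , trans (Listₚ.length-map suc as) as-length) , w-max′
    where
    w-max′ : ∀ bs → Antichain P bs → length bs ≤ w
    w-max′ bs bs-anti with antichain-view bs bs-anti
    ... | inj₁ refl                  = w-max [ x₀ ] ([] ∷ [])
    ... | inj₂ (cs , cs-anti , refl) = subst (_≤ w) (sym (Listₚ.length-map suc cs)) (w-max cs cs-anti)

-- Disjoint unions

module _ {A B : Set} where

  lefts : List (A ⊎ B) → List A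
  lefts []            = []
  lefts (inj₁ x ∷ us) = x ∷ lefts us
  lefts (inj₂ _ ∷ us) = lefts us

  rights : List (A ⊎ B) → List B
  rights []            = []
  rights (inj₁ _ ∷ us) = rights us
  rights (inj₂ y ∷ us) = y ∷ rights us

  length-lefts+rights : ∀ us → length (lefts us) ℕ.+ length (rights us) ≡ length us
  length-lefts+rights []            = refl
  length-lefts+rights (inj₁ _ ∷ us) = cong suc (length-lefts+rights us)
  length-lefts+rights (inj₂ _ ∷ us) =
    trans (ℕₚ.+-suc (length (lefts us)) _) (cong suc (length-lefts+rights us))

  module _ {P : A ⊎ B → Set} where

    All-lefts : ∀ {us} → All P us → All (P ∘ inj₁) (lefts us)
    All-lefts {[]}          []       = []
    All-lefts {inj₁ _ ∷ _}  (p ∷ ps) = p ∷ All-lefts ps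
    All-lefts {inj₂ _ ∷ _}  (_ ∷ ps) = All-lefts ps

    All-rights : ∀ {us} → All P us → All (P ∘ inj₂) (rights us)
    All-rights {[]}          []       = []
    All-rights {inj₁ _ ∷ _}  (_ ∷ ps) = All-rights ps
    All-rights {inj₂ _ ∷ _}  (p ∷ ps) = p ∷ All-rights ps

  module _ {R : A ⊎ B → A ⊎ B → Set} where

    AllPairs-lefts : ∀ {us} → AllPairs R us → AllPairs (R on inj₁) (lefts us)
    AllPairs-lefts {[]}          []       = []
    AllPairs-lefts {inj₁ _ ∷ _}  (p ∷ ps) = All-lefts p ∷ AllPairs-lefts ps
    AllPairs-lefts {inj₂ _ ∷ _}  (_ ∷ ps) = AllPairs-lefts ps

    AllPairs-rights : ∀ {us} → AllPairs R us → AllPairs (R on inj₂) (rights us)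
    AllPairs-rights {[]}          []       = []
    AllPairs-rights {inj₁ _ ∷ _}  (_ ∷ ps) = AllPairs-rights ps
    AllPairs-rights {inj₂ _ ∷ _}  (p ∷ ps) = All-rights p ∷ AllPairs-rights ps

↑-elim : ∀ {m n} {P : Fin (m ℕ.+ n) → Set} →
         (∀ i → P (i ↑ˡ n)) → (∀ j → P (m ↑ʳ j)) → ∀ z → P z
↑-elim {m} {n} {P} left right z =
  subst P (Finₚ.join-splitAt m n z) (Sum.[_,_] {C = P ∘ join m n} left right (splitAt m z))

module DisjointUnion
  (Q R : FinRel)
  (_⊑_ : Fin (size Q ℕ.+ size R) → Fin (size Q ℕ.+ size R) → Set)
  (_⊑?_ : ∀ x y → Dec (x ⊑ y))
  (↑ˡ-⊑ : ∀ x y → (x ↑ˡ size R) ⊑ (y ↑ˡ size R) ⇔ FinRel._≼_ Q x y)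
  (↑ʳ-⊑ : ∀ x y → (size Q ↑ʳ x) ⊑ (size Q ↑ʳ y) ⇔ FinRel._≼_ R x y)
  (↑ˡ-⋢-↑ʳ : ∀ x y → ¬ ((x ↑ˡ size R) ⊑ (size Q ↑ʳ y)))
  (↑ʳ-⋢-↑ˡ : ∀ x y → ¬ ((size Q ↑ʳ x) ⊑ (y ↑ˡ size R)))
  where

  P : FinRel
  P = record { size = size Q ℕ.+ size R ; _≼_ = _⊑_ ; _≼?_ = _⊑?_ }

  private
    m n : ℕ
    m = size Q
    n = size R

  module Left  = OrderEmbedding Q P (_↑ˡ n) (Finₚ.↑ˡ-injective n _ _) ↑ˡ-⊑
  module Right = OrderEmbedding R P (m ↑ʳ_) (Finₚ.↑ʳ-injective m _ _) ↑ʳ-⊑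

  above-↑ˡ : ∀ x z → _≺_ P (x ↑ˡ n) z → Left.InImage z
  above-↑ˡ x = ↑-elim (λ i _ → i , refl) (λ j x<j → ⊥-elim (↑ˡ-⋢-↑ʳ x j (proj₁ x<j)))

  below-↑ˡ : ∀ x z → _≺_ P z (x ↑ˡ n) → Left.InImage z
  below-↑ˡ x = ↑-elim (λ i _ → i , refl) (λ j j<x → ⊥-elim (↑ʳ-⋢-↑ˡ j x (proj₁ j<x)))

  above-↑ʳ : ∀ x z → _≺_ P (m ↑ʳ x) z → Right.InImage z
  above-↑ʳ x = ↑-elim (λ i x<i → ⊥-elim (↑ʳ-⋢-↑ˡ x i (proj₁ x<i))) (λ j _ → j , refl)

  below-↑ʳ : ∀ x z → _≺_ P z (m ↑ʳ x) → Right.InImage z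
  below-↑ʳ x = ↑-elim (λ i i<x → ⊥-elim (↑ˡ-⋢-↑ʳ i x (proj₁ i<x))) (λ j _ → j , refl)

  count-Covers-↑ˡ : ∀ x → count (Covers? P (x ↑ˡ n)) ≡ count (Covers? Q x)
  count-Covers-↑ˡ x = trans (count-↑ m (Covers? P (x ↑ˡ n)))
    (trans (cong₂ ℕ._+_
             (count-cong (λ y → Covers? P (x ↑ˡ n) (y ↑ˡ n)) (Covers? Q x)
                         (λ y → Left.Covers⇔ (λ z x<z _ → above-↑ˡ x z x<z)))
             (count-none (λ y → Covers? P (x ↑ˡ n) (m ↑ʳ y)) (λ y → ↑ˡ-⋢-↑ʳ x y ∘ proj₁ ∘ proj₁)))
           (ℕₚ.+-identityʳ _))

  count-Covers-↑ʳ : ∀ x → count (Covers? P (m ↑ʳ x)) ≡ count (Covers? R x)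
  count-Covers-↑ʳ x = trans (count-↑ m (Covers? P (m ↑ʳ x)))
    (cong₂ ℕ._+_
      (count-none (λ y → Covers? P (m ↑ʳ x) (y ↑ˡ n)) (λ y → ↑ʳ-⋢-↑ˡ x y ∘ proj₁ ∘ proj₁))
      (count-cong (λ y → Covers? P (m ↑ʳ x) (m ↑ʳ y)) (Covers? R x)
                  (λ y → Right.Covers⇔ (λ z x<z _ → above-↑ʳ x z x<z))))

  eP-⊕ : eP P ≡ eP Q ℕ.+ eP R
  eP-⊕ = begin
    eP P                                                              ≡⟨ eP≡∑count P ⟩
    ∑[ z < m ℕ.+ n ] count (Covers? P z)                              ≡⟨ ∑-↑ m _ ⟩
    ∑[ x < m ] count (Covers? P (x ↑ˡ n)) ℕ.+ ∑[ y < n ] count (Covers? P (m ↑ʳ y))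
      ≡⟨ cong₂ ℕ._+_ (sum-cong-≗ count-Covers-↑ˡ) (sum-cong-≗ count-Covers-↑ʳ) ⟩
    ∑[ x < m ] count (Covers? Q x) ℕ.+ ∑[ y < n ] count (Covers? R y) ≡⟨ cong₂ ℕ._+_ (eP≡∑count Q) (eP≡∑count R) ⟨
    eP Q ℕ.+ eP R                                                     ∎
    where open ≡-Reasoning

  MP-⊕ : MP P ≡ MP Q ℕ.+ MP R
  MP-⊕ = trans (count-↑ m (IsMaximal? P)) (cong₂ ℕ._+_
    (count-cong (λ x → IsMaximal? P (x ↑ˡ n)) (IsMaximal? Q) (λ x → Left.IsMaximal⇔ (above-↑ˡ x)))
    (count-cong (λ y → IsMaximal? P (m ↑ʳ y)) (IsMaximal? R) (λ y → Right.IsMaximal⇔ (above-↑ʳ y))))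

  mP-⊕ : mP P ≡ mP Q ℕ.+ mP R
  mP-⊕ = trans (count-↑ m (IsMinimal? P)) (cong₂ ℕ._+_
    (count-cong (λ x → IsMinimal? P (x ↑ˡ n)) (IsMinimal? Q) (λ x → Left.IsMinimal⇔ (below-↑ˡ x)))
    (count-cong (λ y → IsMinimal? P (m ↑ʳ y)) (IsMinimal? R) (λ y → Right.IsMinimal⇔ (below-↑ʳ y))))

  Balanced-⊕ : ∀ {v w} → Balanced Q v → Balanced R w → Balanced P (v ℕ.+ w)
  Balanced-⊕ {v} {w} Q-balanced R-balanced = begin
    eP P ℕ.+ MP P ℕ.+ mP P
      ≡⟨ cong₂ ℕ._+_ (cong₂ ℕ._+_ eP-⊕ MP-⊕) mP-⊕ ⟩
    (eP Q ℕ.+ eP R) ℕ.+ (MP Q ℕ.+ MP R) ℕ.+ (mP Q ℕ.+ mP R)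
      ≡⟨ interchange (eP Q) (eP R) (MP Q) (MP R) (mP Q) (mP R) ⟩
    (eP Q ℕ.+ MP Q ℕ.+ mP Q) ℕ.+ (eP R ℕ.+ MP R ℕ.+ mP R)
      ≡⟨ cong₂ ℕ._+_ Q-balanced R-balanced ⟩
    (m ℕ.+ v) ℕ.+ (n ℕ.+ w)
      ≡⟨ +-interchange m v n w ⟩
    (m ℕ.+ n) ℕ.+ (v ℕ.+ w)
      ∎
    where
    open ≡-Reasoning
    interchange : ∀ a b c d e f → (a ℕ.+ b) ℕ.+ (c ℕ.+ d) ℕ.+ (e ℕ.+ f) ≡ (a ℕ.+ c ℕ.+ e) ℕ.+ (b ℕ.+ d ℕ.+ f)
    interchange = solve-∀

  IsWidth-⊕ : ∀ {v w} → IsWidth Q v → IsWidth R w → IsWidth P (v ℕ.+ w)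
  IsWidth-⊕ {v} {w} ((as , as-anti , as-length) , v-max) ((bs , bs-anti , bs-length) , w-max) =
    (map (_↑ˡ n) as ++ map (m ↑ʳ_) bs , union-anti , union-length) , vw-max
    where
    incomparable-↑ˡ↑ʳ : ∀ x y → Incomparable P (x ↑ˡ n) (m ↑ʳ y)
    incomparable-↑ˡ↑ʳ x y = ↑ˡ-⋢-↑ʳ x y , ↑ʳ-⋢-↑ˡ y x

    union-anti : Antichain P (map (_↑ˡ n) as ++ map (m ↑ʳ_) bs)
    union-anti = AllPairsₚ.++⁺ (Left.Antichain-map as-anti) (Right.Antichain-map bs-anti)
      (Allₚ.map⁺ (All.universal (λ x → Allₚ.map⁺ (All.universal (incomparable-↑ˡ↑ʳ x) bs)) as))

    union-length : length (map (_↑ˡ n) as ++ map (m ↑ʳ_) bs) ≡ v ℕ.+ w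
    union-length = trans (Listₚ.length-++ (map (_↑ˡ n) as))
      (cong₂ ℕ._+_ (trans (Listₚ.length-map _ as) as-length) (trans (Listₚ.length-map _ bs) bs-length))

    vw-max : ∀ cs → Antichain P cs → length cs ≤ v ℕ.+ w
    vw-max cs cs-anti = subst (_≤ v ℕ.+ w) cs-length
      (ℕₚ.+-mono-≤ (v-max (lefts us) (AllPairs.map (to Left.Incomparable⇔) (AllPairs-lefts us-anti)))
                   (w-max (rights us) (AllPairs.map (to Right.Incomparable⇔) (AllPairs-rights us-anti))))
      where
      us : List (Fin m ⊎ Fin n)
      us = map (splitAt m) cs
      us-anti : AllPairs (Incomparable P on join m n) us
      us-anti = AllPairsₚ.map⁺ (AllPairs.map
        (λ {x} {y} → subst₂ (Incomparable P) (sym (Finₚ.join-splitAt m n x)) (sym (Finₚ.join-splitAt m n y)))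
        cs-anti)
      cs-length : length (lefts us) ℕ.+ length (rights us) ≡ length cs
      cs-length = trans (length-lefts+rights us) (Listₚ.length-map (splitAt m) cs)

-- 𝒱-posets

leaves : VTree → ℕ
leaves point      = 1
leaves (t ⊕ s)    = leaves t ℕ.+ leaves s
leaves (addTop t) = leaves t
leaves (addBot t) = leaves t

anElement : ∀ t → Fin (vsize t)
anElement point      = zero
anElement (t ⊕ s)    = anElement t ↑ˡ vsize s
anElement (addTop t) = zero
anElement (addBot t) = zero

module _ (t s : VTree) where

  VLe-↑ˡ : ∀ x y → VLe (t ⊕ s) (x ↑ˡ vsize s) (y ↑ˡ vsize s) ⇔ VLe t x y
  VLe-↑ˡ x y rewrite Finₚ.splitAt-↑ˡ (vsize t) x (vsize s) | Finₚ.splitAt-↑ˡ (vsize t) y (vsize s) = ⇔-id _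

  VLe-↑ʳ : ∀ x y → VLe (t ⊕ s) (vsize t ↑ʳ x) (vsize t ↑ʳ y) ⇔ VLe s x y
  VLe-↑ʳ x y rewrite Finₚ.splitAt-↑ʳ (vsize t) (vsize s) x | Finₚ.splitAt-↑ʳ (vsize t) (vsize s) y = ⇔-id _

  VLe-↑ˡ↑ʳ : ∀ x y → ¬ VLe (t ⊕ s) (x ↑ˡ vsize s) (vsize t ↑ʳ y)
  VLe-↑ˡ↑ʳ x y rewrite Finₚ.splitAt-↑ˡ (vsize t) x (vsize s) | Finₚ.splitAt-↑ʳ (vsize t) (vsize s) y = λ ()

  VLe-↑ʳ↑ˡ : ∀ x y → ¬ VLe (t ⊕ s) (vsize t ↑ʳ x) (y ↑ˡ vsize s)
  VLe-↑ʳ↑ˡ x y rewrite Finₚ.splitAt-↑ʳ (vsize t) (vsize s) x | Finₚ.splitAt-↑ˡ (vsize t) y (vsize s) = λ ()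

module _ (t : VTree) where

  VLe-addTop-suc : ∀ x y → VLe (addTop t) (suc x) (suc y) ⇔ VLe t x y
  VLe-addTop-suc x y = ⇔-id _

  VLe-addTop-top : ∀ x → VLe (addTop t) x zero
  VLe-addTop-top x = tt

  VLe-addTop-⋢ : ∀ y → ¬ VLe (addTop t) zero (suc y)
  VLe-addTop-⋢ y ()

  VLe-addBot-suc : ∀ x y → VLe (addBot t) (suc y) (suc x) ⇔ VLe t y x
  VLe-addBot-suc x y = ⇔-id _

  VLe-addBot-bottom : ∀ x → VLe (addBot t) zero x
  VLe-addBot-bottom x = tt

  VLe-addBot-⋢ : ∀ y → ¬ VLe (addBot t) (suc y) zero
  VLe-addBot-⋢ y ()

module Union (t s : VTree) =
  DisjointUnion ⟦ t ⟧ ⟦ s ⟧ (VLe (t ⊕ s)) (VLe? (t ⊕ s)) (VLe-↑ˡ t s) (VLe-↑ʳ t s) (VLe-↑ˡ↑ʳ t s) (VLe-↑ʳ↑ˡ t s)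

module AddTop (t : VTree) =
  AdjoinGreatest ⟦ t ⟧ (VLe (addTop t)) (VLe? (addTop t))
                 (VLe-addTop-suc t) (VLe-addTop-top t) (VLe-addTop-⋢ t)

-- Its opposite is definitionally ⟦ addBot t ⟧.
module AddBotᵒᵖ (t : VTree) =
  AdjoinGreatest (⟦ t ⟧ ᵒᵖ) (flip (VLe (addBot t))) (flip (VLe? (addBot t)))
                 (VLe-addBot-suc t) (VLe-addBot-bottom t) (VLe-addBot-⋢ t)

IsWidth-leaves : ∀ t → IsWidth ⟦ t ⟧ (leaves t)
IsWidth-leaves point      = ([ zero ] , [] ∷ [] , refl) , point-max
  where
  point-max : ∀ as → Antichain ⟦ point ⟧ as → length as ≤ 1
  point-max []            _                = ℕ.z≤n
  point-max (_ ∷ [])      _                = ℕ.s≤s ℕ.z≤n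
  point-max (_ ∷ _ ∷ _)   ((x#y ∷ _) ∷ _)  = ⊥-elim (proj₁ x#y tt)
IsWidth-leaves (t ⊕ s)    = Union.IsWidth-⊕ t s (IsWidth-leaves t) (IsWidth-leaves s)
IsWidth-leaves (addTop t) = AddTop.IsWidth-adjoin t (anElement t) (IsWidth-leaves t)
IsWidth-leaves (addBot t) =
  IsWidth-ᵒᵖ (AddBotᵒᵖ.P t) (AddBotᵒᵖ.IsWidth-adjoin t (anElement t) (IsWidth-ᵒᵖ ⟦ t ⟧ (IsWidth-leaves t)))

Balanced-leaves : ∀ t → Balanced ⟦ t ⟧ (leaves t)
Balanced-leaves point      = refl
Balanced-leaves (t ⊕ s)    = Union.Balanced-⊕ t s (Balanced-leaves t) (Balanced-leaves s)
Balanced-leaves (addTop t) = AddTop.Balanced-adjoin t (anElement t) (Balanced-leaves t)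
Balanced-leaves (addBot t) =
  Balanced-ᵒᵖ (AddBotᵒᵖ.P t) (AddBotᵒᵖ.Balanced-adjoin t (anElement t) (Balanced-ᵒᵖ ⟦ t ⟧ (Balanced-leaves t)))

Balanced⇒edge-formula : ∀ P {w} → Balanced P w → + eP P ≡ + nP P + + w - + MP P - + mP P
Balanced⇒edge-formula P {w} balanced = begin
  + e                         ≡⟨ cancel (+ e) (+ M) (+ m) ⟨
  + e + + M + + m - + M - + m ≡⟨ cong (λ k → k - + M - + m) ℕ-sum ⟩
  + nP P + + w - + M - + m    ∎
  where
  open ≡-Reasoning
  e M m : ℕ
  e = eP P
  M = MP P
  m = mP P
  cancel : ∀ a b c → a + b + c - b - c ≡ a
  cancel = ℤ-Solver.solve-∀
  ℕ-sum : + e + + M + + m ≡ + nP P + + w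
  ℕ-sum = begin
    + e + + M + + m            ≡⟨ cong (_+ + m) (ℤₚ.pos-+ e M) ⟨
    + (e ℕ.+ M) + + m          ≡⟨ ℤₚ.pos-+ (e ℕ.+ M) m ⟨
    + (e ℕ.+ M ℕ.+ m)          ≡⟨ cong +_ balanced ⟩
    + (nP P ℕ.+ w)             ≡⟨ ℤₚ.pos-+ (nP P) w ⟩
    + nP P + + w               ∎

mainTheorem12 : (t : VTree) (w : ℕ) → IsWidth ⟦ t ⟧ w →
    + eP ⟦ t ⟧ ≡ + nP ⟦ t ⟧ + + w - + MP ⟦ t ⟧ - + mP ⟦ t ⟧
mainTheorem12 t w w-width with IsWidth-unique ⟦ t ⟧ w-width (IsWidth-leaves t)
... | refl = Balanced⇒edge-formula ⟦ t ⟧ (Balanced-leaves t)
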